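{- Over the calculus QHC (described in the context), the $?^*$-Principle $(?\alpha\to ?\beta)\leftrightarrow ?(\nabla\alpha\to\nabla\beta)$ is equivalent to the schema $?(\alpha\to\beta)\leftrightarrow(?\alpha\to ?\beta)$, and implies the $?$-Principle $?(\alpha\to\beta)\leftrightarrow\Box(?\alpha\to ?\beta)$.
   Context: QHC (the joint logic of problems and propositions) is a two-sorted first-order calculus over a single domain of individuals. Formulas are of two sorts: propositions (letters $p,q$) and problems (letters $\alpha,\beta$). Propositions are built from atomic propositions and from expressions $?\alpha$ ($\alpha$ a problem) by the classical connectives $\land,\lor,\to,\neg$, the constant $0$ (falsity) and quantifiers $\forall x,\exists x$. Problems are built from atomic problems and from expressions $!p$ ($p$ a proposition) by the intuitionistic connectives $\land,\lor,\to,\neg$, the constant $\bot$ and quantifiers $\forall x,\exists x$. Derivability in QHC: all axioms and rules of classical predicate logic apply to propositions, all axioms and rules of intuitionistic predicate logic apply to problems, and in addition there are the inference rules "from $\alpha$ infer $?\alpha$" and "from $p$ infer $!p$", and the axiom schemes $?(\alpha\to\beta)\to(?\alpha\to ?\beta)$, $!(p\to q)\to(!p\to !q)$, $\neg !0$, $?!p\to p$, $\alpha\to !?\alpha$. Abbreviations: $\Box p:= ?!p$ for propositions, $\nabla\alpha := !?\alpha$ for problems; $A\leftrightarrow B$ abbreviates $(A\to B)\land(B\to A)$. A principle is a schema added to QHC as extra axioms (all instances for arbitrary problems $\alpha,\beta$). "X implies Y" means Y is derivable in QHC extended by X; "equivalent" means each implies the other. -}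

module Defs where

open import Data.Nat using (ℕ; zero; suc)
open import Data.Fin using (Fin; zero; suc)
open import Data.List using (List; map)
open import Data.Product using (_×_)

-- Formulas are well-scoped: `Prop n` / `Prob n` are
-- formulas whose free individual variables are among the n de Bruijn
-- variables `Fin n`.  Individual terms are variables (no function
-- symbols).  Atomic formulas: a predicate name (ℕ) applied to a list of
-- variables.
--   ¿ α   renders  ?α   (proposition from a problem)
--   ¡ p   renders  !p   (problem from a proposition)

infixr 6 _∧ᵖ_ _∧ᵇ_
infixr 5 _∨ᵖ_ _∨ᵇ_
infixr 4 _⇒ᵖ_ _⇒ᵇ_

mutual
  data Prop (n : ℕ) : Set where
    atomᵖ : ℕ → List (Fin n) → Prop n
    ¿_    : Prob n → Prop n
    _∧ᵖ_ _∨ᵖ_ _⇒ᵖ_ : Prop n → Prop n → Prop n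
    ¬ᵖ_   : Prop n → Prop n
    𝟘     : Prop n
    ∀ᵖ ∃ᵖ : Prop (suc n) → Prop n

  data Prob (n : ℕ) : Set where
    atomᵇ : ℕ → List (Fin n) → Prob n
    ¡_    : Prop n → Prob n
    _∧ᵇ_ _∨ᵇ_ _⇒ᵇ_ : Prob n → Prob n → Prob n
    ¬ᵇ_   : Prob n → Prob n
    ⊥ᵇ    : Prob n
    ∀ᵇ ∃ᵇ : Prob (suc n) → Prob n

-- Renaming of individual variables (terms are variables, so this is
-- also substitution).
lift : ∀ {n m} → (Fin n → Fin m) → Fin (suc n) → Fin (suc m)
lift ρ zero    = zero
lift ρ (suc i) = suc (ρ i)

mutual
  renᵖ : ∀ {n m} → (Fin n → Fin m) → Prop n → Prop m
  renᵖ ρ (atomᵖ P xs) = atomᵖ P (map ρ xs)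
  renᵖ ρ (¿ α)    = ¿ renᵇ ρ α
  renᵖ ρ (p ∧ᵖ q) = renᵖ ρ p ∧ᵖ renᵖ ρ q
  renᵖ ρ (p ∨ᵖ q) = renᵖ ρ p ∨ᵖ renᵖ ρ q
  renᵖ ρ (p ⇒ᵖ q) = renᵖ ρ p ⇒ᵖ renᵖ ρ q
  renᵖ ρ (¬ᵖ p)   = ¬ᵖ renᵖ ρ p
  renᵖ ρ 𝟘        = 𝟘
  renᵖ ρ (∀ᵖ p)   = ∀ᵖ (renᵖ (lift ρ) p)
  renᵖ ρ (∃ᵖ p)   = ∃ᵖ (renᵖ (lift ρ) p)

  renᵇ : ∀ {n m} → (Fin n → Fin m) → Prob n → Prob m
  renᵇ ρ (atomᵇ P xs) = atomᵇ P (map ρ xs)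
  renᵇ ρ (¡ p)    = ¡ renᵖ ρ p
  renᵇ ρ (a ∧ᵇ b) = renᵇ ρ a ∧ᵇ renᵇ ρ b
  renᵇ ρ (a ∨ᵇ b) = renᵇ ρ a ∨ᵇ renᵇ ρ b
  renᵇ ρ (a ⇒ᵇ b) = renᵇ ρ a ⇒ᵇ renᵇ ρ b
  renᵇ ρ (¬ᵇ a)   = ¬ᵇ renᵇ ρ a
  renᵇ ρ ⊥ᵇ       = ⊥ᵇ
  renᵇ ρ (∀ᵇ a)   = ∀ᵇ (renᵇ (lift ρ) a)
  renᵇ ρ (∃ᵇ a)   = ∃ᵇ (renᵇ (lift ρ) a)

inst : ∀ {n} → Fin n → Fin (suc n) → Fin n
inst t zero    = t
inst t (suc i) = i

_[_]ᵖ : ∀ {n} → Prop (suc n) → Fin n → Prop n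
p [ t ]ᵖ = renᵖ (inst t) p

_[_]ᵇ : ∀ {n} → Prob (suc n) → Fin n → Prob n
a [ t ]ᵇ = renᵇ (inst t) a

wkᵖ : ∀ {n} → Prop n → Prop (suc n)
wkᵖ = renᵖ suc

wkᵇ : ∀ {n} → Prob n → Prob (suc n)
wkᵇ = renᵇ suc

_⇔ᵖ_ : ∀ {n} → Prop n → Prop n → Prop n
p ⇔ᵖ q = (p ⇒ᵖ q) ∧ᵖ (q ⇒ᵖ p)

□_ : ∀ {n} → Prop n → Prop n
□ p = ¿ (¡ p)

∇_ : ∀ {n} → Prob n → Prob n
∇ α = ¡ (¿ α)

-- A principle: a schema in two problem metavariables α, β, producing
-- a proposition (instances at every number of free variables).
Schema : Set
Schema = ∀ {n} → Prob n → Prob n → Prop n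

-- Derivability in QHC + S (S an extra axiom schema).
-- Hilbert-style: classical predicate logic on propositions,
-- intuitionistic predicate logic on problems, plus the QHC rules/axioms.
-- Derivations are of formulas with free variables among Fin n; the rule
-- `nonemptyᵖ/ᵇ` expresses the usual nonempty-domain convention.

mutual
  data _⊢ᵖ_ (S : Schema) : ∀ {n} → Prop n → Set where
    K    : ∀ {n} {p q : Prop n} → S ⊢ᵖ (p ⇒ᵖ (q ⇒ᵖ p))
    Sₐ   : ∀ {n} {p q r : Prop n} →
           S ⊢ᵖ ((p ⇒ᵖ (q ⇒ᵖ r)) ⇒ᵖ ((p ⇒ᵖ q) ⇒ᵖ (p ⇒ᵖ r)))
    ∧I   : ∀ {n} {p q : Prop n} → S ⊢ᵖ (p ⇒ᵖ (q ⇒ᵖ (p ∧ᵖ q)))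
    ∧E₁  : ∀ {n} {p q : Prop n} → S ⊢ᵖ ((p ∧ᵖ q) ⇒ᵖ p)
    ∧E₂  : ∀ {n} {p q : Prop n} → S ⊢ᵖ ((p ∧ᵖ q) ⇒ᵖ q)
    ∨I₁  : ∀ {n} {p q : Prop n} → S ⊢ᵖ (p ⇒ᵖ (p ∨ᵖ q))
    ∨I₂  : ∀ {n} {p q : Prop n} → S ⊢ᵖ (q ⇒ᵖ (p ∨ᵖ q))
    ∨E   : ∀ {n} {p q r : Prop n} →
           S ⊢ᵖ ((p ⇒ᵖ r) ⇒ᵖ ((q ⇒ᵖ r) ⇒ᵖ ((p ∨ᵖ q) ⇒ᵖ r)))
    𝟘E   : ∀ {n} {p : Prop n} → S ⊢ᵖ (𝟘 ⇒ᵖ p)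
    ¬E   : ∀ {n} {p : Prop n} → S ⊢ᵖ ((¬ᵖ p) ⇒ᵖ (p ⇒ᵖ 𝟘))
    ¬I   : ∀ {n} {p : Prop n} → S ⊢ᵖ ((p ⇒ᵖ 𝟘) ⇒ᵖ (¬ᵖ p))
    DNE  : ∀ {n} {p : Prop n} → S ⊢ᵖ ((¬ᵖ (¬ᵖ p)) ⇒ᵖ p)
    MP   : ∀ {n} {p q : Prop n} → S ⊢ᵖ (p ⇒ᵖ q) → S ⊢ᵖ p → S ⊢ᵖ q
    ∀E   : ∀ {n} {p : Prop (suc n)} (t : Fin n) → S ⊢ᵖ ((∀ᵖ p) ⇒ᵖ (p [ t ]ᵖ))
    ∀I   : ∀ {n} {p : Prop n} {q : Prop (suc n)} →
           S ⊢ᵖ ((∀ᵖ (wkᵖ p ⇒ᵖ q)) ⇒ᵖ (p ⇒ᵖ ∀ᵖ q))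
    ∃I   : ∀ {n} {p : Prop (suc n)} (t : Fin n) → S ⊢ᵖ ((p [ t ]ᵖ) ⇒ᵖ (∃ᵖ p))
    ∃E   : ∀ {n} {p : Prop (suc n)} {q : Prop n} →
           S ⊢ᵖ ((∀ᵖ (p ⇒ᵖ wkᵖ q)) ⇒ᵖ ((∃ᵖ p) ⇒ᵖ q))
    Gen  : ∀ {n} {p : Prop (suc n)} → S ⊢ᵖ p → S ⊢ᵖ (∀ᵖ p)
    nonemptyᵖ : ∀ {n} {p : Prop n} → S ⊢ᵖ (wkᵖ p) → S ⊢ᵖ p
    ?-rule : ∀ {n} {α : Prob n} → S ⊢ᵇ α → S ⊢ᵖ (¿ α)
    ?-K    : ∀ {n} {α β : Prob n} → S ⊢ᵖ ((¿ (α ⇒ᵇ β)) ⇒ᵖ ((¿ α) ⇒ᵖ (¿ β)))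
    ?!-ax  : ∀ {n} {p : Prop n} → S ⊢ᵖ ((¿ (¡ p)) ⇒ᵖ p)
    ext    : ∀ {n} (α β : Prob n) → S ⊢ᵖ S α β

  data _⊢ᵇ_ (S : Schema) : ∀ {n} → Prob n → Set where
    K    : ∀ {n} {a b : Prob n} → S ⊢ᵇ (a ⇒ᵇ (b ⇒ᵇ a))
    Sₐ   : ∀ {n} {a b c : Prob n} →
           S ⊢ᵇ ((a ⇒ᵇ (b ⇒ᵇ c)) ⇒ᵇ ((a ⇒ᵇ b) ⇒ᵇ (a ⇒ᵇ c)))
    ∧I   : ∀ {n} {a b : Prob n} → S ⊢ᵇ (a ⇒ᵇ (b ⇒ᵇ (a ∧ᵇ b)))
    ∧E₁  : ∀ {n} {a b : Prob n} → S ⊢ᵇ ((a ∧ᵇ b) ⇒ᵇ a)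
    ∧E₂  : ∀ {n} {a b : Prob n} → S ⊢ᵇ ((a ∧ᵇ b) ⇒ᵇ b)
    ∨I₁  : ∀ {n} {a b : Prob n} → S ⊢ᵇ (a ⇒ᵇ (a ∨ᵇ b))
    ∨I₂  : ∀ {n} {a b : Prob n} → S ⊢ᵇ (b ⇒ᵇ (a ∨ᵇ b))
    ∨E   : ∀ {n} {a b c : Prob n} →
           S ⊢ᵇ ((a ⇒ᵇ c) ⇒ᵇ ((b ⇒ᵇ c) ⇒ᵇ ((a ∨ᵇ b) ⇒ᵇ c)))
    ⊥E   : ∀ {n} {a : Prob n} → S ⊢ᵇ (⊥ᵇ ⇒ᵇ a)
    ¬E   : ∀ {n} {a : Prob n} → S ⊢ᵇ ((¬ᵇ a) ⇒ᵇ (a ⇒ᵇ ⊥ᵇ))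
    ¬I   : ∀ {n} {a : Prob n} → S ⊢ᵇ ((a ⇒ᵇ ⊥ᵇ) ⇒ᵇ (¬ᵇ a))
    MP   : ∀ {n} {a b : Prob n} → S ⊢ᵇ (a ⇒ᵇ b) → S ⊢ᵇ a → S ⊢ᵇ b
    ∀E   : ∀ {n} {a : Prob (suc n)} (t : Fin n) → S ⊢ᵇ ((∀ᵇ a) ⇒ᵇ (a [ t ]ᵇ))
    ∀I   : ∀ {n} {a : Prob n} {b : Prob (suc n)} →
           S ⊢ᵇ ((∀ᵇ (wkᵇ a ⇒ᵇ b)) ⇒ᵇ (a ⇒ᵇ ∀ᵇ b))
    ∃I   : ∀ {n} {a : Prob (suc n)} (t : Fin n) → S ⊢ᵇ ((a [ t ]ᵇ) ⇒ᵇ (∃ᵇ a))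
    ∃E   : ∀ {n} {a : Prob (suc n)} {b : Prob n} →
           S ⊢ᵇ ((∀ᵇ (a ⇒ᵇ wkᵇ b)) ⇒ᵇ ((∃ᵇ a) ⇒ᵇ b))
    Gen  : ∀ {n} {a : Prob (suc n)} → S ⊢ᵇ a → S ⊢ᵇ (∀ᵇ a)
    nonemptyᵇ : ∀ {n} {a : Prob n} → S ⊢ᵇ (wkᵇ a) → S ⊢ᵇ a
    !-rule : ∀ {n} {p : Prop n} → S ⊢ᵖ p → S ⊢ᵇ (¡ p)
    !-K    : ∀ {n} {p q : Prop n} → S ⊢ᵇ ((¡ (p ⇒ᵖ q)) ⇒ᵇ ((¡ p) ⇒ᵇ (¡ q)))
    ¬!0    : ∀ {n} → S ⊢ᵇ (¬ᵇ (¡ (𝟘 {n})))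
    α→!?α  : ∀ {n} {α : Prob n} → S ⊢ᵇ (α ⇒ᵇ (¡ (¿ α)))

?*-Principle : Schema
?*-Principle α β = ((¿ α) ⇒ᵖ (¿ β)) ⇔ᵖ (¿ ((∇ α) ⇒ᵇ (∇ β)))

?-Distrib : Schema
?-Distrib α β = (¿ (α ⇒ᵇ β)) ⇔ᵖ ((¿ α) ⇒ᵖ (¿ β))

?-Principle : Schema
?-Principle α β = (¿ (α ⇒ᵇ β)) ⇔ᵖ (□ ((¿ α) ⇒ᵖ (¿ β)))

_implies_ : Schema → Schema → Set
X implies Y = ∀ {n} (α β : Prob n) → X ⊢ᵖ Y α β

_equivalent_ : Schema → Schema → Set
X equivalent Y = (X implies Y) × (Y implies X)

-- ?α and ?∇α are interderivable (α → !?α and ?!p → p), so the ?*-Principle only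
-- differs from ?-Distrib in its converse half (?α → ?β) → ?(α → β). Classically,
-- either ?β, and then ?(α → β) since ⊢ β → (α → β); or ¬?α, and then the
-- ?*-Principle at β := ⊥ gives ?(∇α → ∇⊥), where ∇⊥ = !?⊥ is refutable
-- (?⊥ → 0 and ¬!0), so ∇α → ∇⊥ yields α → β. The same converse turns
-- □(?α → ?β) into ?(α → β), giving the ?-Principle.
module Submission where

open import Defs
open import Data.Product using (_×_; _,_)
open import Data.Nat using (ℕ)

-- A context Γ is read as the curried implication [ Γ ] q, so abstraction is free
-- and the deduction theorem for a K/S/MP calculus reduces to application.
module Deduction {F : Set} (_⊃_ : F → F → F) (⊢_ : F → Set)
  (K  : ∀ {a b} → ⊢ (a ⊃ (b ⊃ a)))
  (S  : ∀ {a b c} → ⊢ ((a ⊃ (b ⊃ c)) ⊃ ((a ⊃ b) ⊃ (a ⊃ c))))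
  (MP : ∀ {a b} → ⊢ (a ⊃ b) → ⊢ a → ⊢ b) where

  infixl 5 _▸_
  infix 30 [_]_
  infix 4 _⊩_

  data Ctx : Set where
    ε   : Ctx
    _▸_ : Ctx → F → Ctx

  [_]_ : Ctx → F → F
  [ ε ]     q = q
  [ Γ ▸ p ] q = [ Γ ] (p ⊃ q)

  record _⊩_ (Γ : Ctx) (q : F) : Set where
    constructor ⟨_⟩
    field derivation : ⊢ ([ Γ ] q)

  ⊃-refl : ∀ {a} → ⊢ (a ⊃ a)
  ⊃-refl {a} = MP (MP S K) (K {a} {a})

  ⊃-trans : ∀ {a b c} → ⊢ (a ⊃ b) → ⊢ (b ⊃ c) → ⊢ (a ⊃ c)
  ⊃-trans f g = MP (MP S (MP K g)) f

  private
    closed′ : ∀ Γ {a} → ⊢ a → ⊢ ([ Γ ] a)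
    closed′ ε       h = h
    closed′ (Γ ▸ p) h = closed′ Γ (MP K h)

    map-ctx : ∀ Γ {a b} → ⊢ (a ⊃ b) → ⊢ (([ Γ ] a) ⊃ ([ Γ ] b))
    map-ctx ε       h = h
    map-ctx (Γ ▸ p) h = map-ctx Γ (MP S (MP K h))

    distrib-ctx : ∀ Γ {a b} → ⊢ (([ Γ ] (a ⊃ b)) ⊃ (([ Γ ] a) ⊃ ([ Γ ] b)))
    distrib-ctx ε       = ⊃-refl
    distrib-ctx (Γ ▸ p) = ⊃-trans (map-ctx Γ S) (distrib-ctx Γ)

  closed : ∀ {Γ a} → ⊢ a → Γ ⊩ a
  closed {Γ} h = ⟨ closed′ Γ h ⟩

  app : ∀ {Γ a b} → Γ ⊩ (a ⊃ b) → Γ ⊩ a → Γ ⊩ b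
  app {Γ} ⟨ f ⟩ ⟨ x ⟩ = ⟨ MP (MP (distrib-ctx Γ) f) x ⟩

  by : ∀ {Γ a b} → ⊢ (a ⊃ b) → Γ ⊩ a → Γ ⊩ b
  by h = app (closed h)

  weaken : ∀ {Γ p a} → Γ ⊩ a → Γ ▸ p ⊩ a
  weaken {Γ} ⟨ x ⟩ = ⟨ MP (map-ctx Γ K) x ⟩

  var₀ : ∀ {Γ p} → Γ ▸ p ⊩ p
  var₀ {Γ} = ⟨ closed′ Γ ⊃-refl ⟩

  var₁ : ∀ {Γ p q} → Γ ▸ p ▸ q ⊩ p
  var₁ = weaken var₀

  var₂ : ∀ {Γ p q r} → Γ ▸ p ▸ q ▸ r ⊩ p
  var₂ = weaken var₁

  lam : ∀ {Γ p a} → Γ ▸ p ⊩ a → Γ ⊩ (p ⊃ a)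
  lam ⟨ x ⟩ = ⟨ x ⟩

  discharge : ∀ {a} → ε ⊩ a → ⊢ a
  discharge ⟨ x ⟩ = x

module Derivations (S : Schema) {n : ℕ} where
  module P = Deduction (_⇒ᵖ_ {n}) (λ p → S ⊢ᵖ p) _⊢ᵖ_.K _⊢ᵖ_.Sₐ _⊢ᵖ_.MP
  module B = Deduction (_⇒ᵇ_ {n}) (λ a → S ⊢ᵇ a) _⊢ᵇ_.K _⊢ᵇ_.Sₐ _⊢ᵇ_.MP
  open P using (_▸_)

  ∧ᵖ-intro : {p q : Prop n} → S ⊢ᵖ p → S ⊢ᵖ q → S ⊢ᵖ (p ∧ᵖ q)
  ∧ᵖ-intro x y = _⊢ᵖ_.MP (_⊢ᵖ_.MP ∧I x) y

  ¿-mono : {α β : Prob n} → S ⊢ᵇ (α ⇒ᵇ β) → S ⊢ᵖ ((¿ α) ⇒ᵖ (¿ β))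
  ¿-mono h = _⊢ᵖ_.MP ?-K (?-rule h)

  ¡-mono : {p q : Prop n} → S ⊢ᵖ (p ⇒ᵖ q) → S ⊢ᵇ ((¡ p) ⇒ᵇ (¡ q))
  ¡-mono h = _⊢ᵇ_.MP !-K (!-rule h)

  ¿⇒¿∇ : {α : Prob n} → S ⊢ᵖ ((¿ α) ⇒ᵖ (¿ (∇ α)))
  ¿⇒¿∇ = ¿-mono α→!?α

  ¿∇⇒¿ : {α : Prob n} → S ⊢ᵖ ((¿ (∇ α)) ⇒ᵖ (¿ α))
  ¿∇⇒¿ = ?!-ax

  ¿∇-K : {α β : Prob n} → S ⊢ᵖ ((¿ ((∇ α) ⇒ᵇ (∇ β))) ⇒ᵖ ((¿ α) ⇒ᵖ (¿ β)))
  ¿∇-K = P.discharge (P.lam (P.lam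
           (P.by ¿∇⇒¿ (P.app (P.by ?-K P.var₁) (P.by ¿⇒¿∇ P.var₀)))))

  ¿-const : {α β : Prob n} → S ⊢ᵖ ((¿ β) ⇒ᵖ (¿ (α ⇒ᵇ β)))
  ¿-const = ¿-mono _⊢ᵇ_.K

  ¿⊥⇒𝟘 : S ⊢ᵖ ((¿ (⊥ᵇ {n})) ⇒ᵖ 𝟘)
  ¿⊥⇒𝟘 = P.⊃-trans (¿-mono ⊥E) ?!-ax

  ∇⊥⇒⊥ : S ⊢ᵇ ((∇ (⊥ᵇ {n})) ⇒ᵇ ⊥ᵇ)
  ∇⊥⇒⊥ = B.⊃-trans (¡-mono ¿⊥⇒𝟘) (_⊢ᵇ_.MP ¬E ¬!0)

  ∇-refutation⇒ex-falso : {α β : Prob n} →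
                          S ⊢ᵇ (((∇ α) ⇒ᵇ (∇ ⊥ᵇ)) ⇒ᵇ (α ⇒ᵇ β))
  ∇-refutation⇒ex-falso = B.discharge (B.lam (B.lam
    (B.by ⊥E (B.by ∇⊥⇒⊥ (B.app B.var₁ (B.by α→!?α B.var₀))))))

  by-contradiction : ∀ {Γ} {p : Prop n} → Γ ▸ (p ⇒ᵖ 𝟘) P.⊩ 𝟘 → Γ P.⊩ p
  by-contradiction h =
    P.by DNE (P.by ¬I (P.lam (P.app (P.weaken (P.lam h)) (P.by ¬E P.var₀))))

¿-Converse : Schema
¿-Converse α β = ((¿ α) ⇒ᵖ (¿ β)) ⇒ᵖ (¿ (α ⇒ᵇ β))

¿-Refutation : Schema
¿-Refutation α β = ((¿ α) ⇒ᵖ 𝟘) ⇒ᵖ (¿ (α ⇒ᵇ β))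

module _ {S : Schema} where
  open Derivations S

  refutation⇒converse : S implies ¿-Refutation → S implies ¿-Converse
  refutation⇒converse refute α β = P.discharge (P.lam (by-contradiction
    (P.app P.var₀ (P.by (refute α β)
      (P.lam (P.app P.var₁ (P.by ¿-const (P.app P.var₂ P.var₀))))))))

  converse⇒?-Distrib : S implies ¿-Converse → S implies ?-Distrib
  converse⇒?-Distrib converse α β = ∧ᵖ-intro ?-K (converse α β)

  converse⇒?-Principle : S implies ¿-Converse → S implies ?-Principle
  converse⇒?-Principle converse α β =
    ∧ᵖ-intro (¿-mono (B.⊃-trans α→!?α (¡-mono ?-K)))
             (P.⊃-trans ?!-ax (converse α β))

?*-Principle⇒refutation : ?*-Principle implies ¿-Refutation
?*-Principle⇒refutation α β = P.discharge (P.lam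
  (P.by (¿-mono ∇-refutation⇒ex-falso)
    (P.by (_⊢ᵖ_.MP ∧E₁ (ext α ⊥ᵇ)) (P.lam (P.by 𝟘E (P.app P.var₁ P.var₀))))))
  where open Derivations ?*-Principle

?-Distrib⇒?*-Principle : ?-Distrib implies ?*-Principle
?-Distrib⇒?*-Principle α β = ∧ᵖ-intro
  (P.discharge (P.lam (P.by (_⊢ᵖ_.MP ∧E₂ (ext (∇ α) (∇ β)))
    (P.lam (P.by ¿⇒¿∇ (P.app P.var₁ (P.by ¿∇⇒¿ P.var₀)))))))
  ¿∇-K
  where open Derivations ?-Distrib

mainTheorem7 : (?*-Principle equivalent ?-Distrib) × (?*-Principle implies ?-Principle)
mainTheorem7 = (converse⇒?-Distrib converse , ?-Distrib⇒?*-Principle)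
             , converse⇒?-Principle converse
  where
  converse : ?*-Principle implies ¿-Converse
  converse = refutation⇒converse ?*-Principle⇒refutation
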